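{- Let $r\ge1$, $n\ge1$, $0\le k<r$, $\lambda\in\mathbb{Z}^{r+1}$ dominant, $\rho=(r,\dots,1,0)$, $\rho_{r-1}=(r-1,\dots,1,0)$, and $w=w_0^{(r-1)}\sigma_r\cdots\sigma_{r-k}$. Write $\mathbf{y}=(x_1,\dots,x_r)$ and $d(\kappa)$ for the coordinate sum of $\kappa$. Then $$\mathbf{x}^{ -w_0(\rho)}\sum_{\mathfrak{T}\in\mathcal{C}^{(w)}_{\lambda+\rho}}G^{(n,\lambda+\rho)}(\mathfrak{T})\,\mathbf{x}^{\mathrm{wt}(\mathfrak{T})}=\sum_{\mu}G^{(n,\lambda+\rho)}(\mathfrak{T}_*^{\mu})\,x_{r+1}^{d(\lambda+\rho)-d(\mu)-r}\Big(\mathbf{y}^{ -w_0^{(r-1)}(\rho_{r-1})}\sum_{\mathfrak{T}'}G^{(n,\mu)}(\mathfrak{T}')\,\mathbf{y}^{\mathrm{wt}(\mathfrak{T}')}\Big),$$ where $\mu=(\mu_1,\dots,\mu_r)$ runs over the weights interleaving with $\lambda+\rho$ with $\mu_j=\lambda_{j+1}+r-j$ for $j>k+1$, $\mathfrak{T}'$ runs over the rank $r-1$ patterns with top row $\mu$ (the vertices of $\mathcal{C}_\mu$), and $\mathfrak{T}_*^\mu$ is the rank $r$ pattern with top row $\lambda+\rho$ whose row $i$ is $(\mu_i,\dots,\mu_r)$ for $1\le i\le r$ (the lowest vertex of $\mathcal{C}_\mu$).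
   Context: $\mathbf{x}=(x_1,\dots,x_{r+1})$, $\mathbf{x}^\nu=\prod x_i^{\nu_i}$; $w_0$ (resp. $w_0^{(r-1)}$) reverses the coordinates of $\mathbb{Z}^{r+1}$ (resp. $\mathbb{Z}^r$). $w_0^{(m)}$ also denotes the word $\sigma_1(\sigma_2\sigma_1)\cdots(\sigma_m\cdots\sigma_1)$ in the generators $\sigma_i=(i\ i+1)$. Interleaving: $\lambda_1+r\ge\mu_1\ge\lambda_2+r-1\ge\dots\ge\lambda_r+1\ge\mu_r\ge\lambda_{r+1}$. Parameters: $v=q^{ -1}$, Gauss sums $g_j=\sum_{b\in(\mathfrak{o}_S/p)^\times}(b/p)_n^{\,j}\psi(b/p)$ ($\mathfrak{o}_S$ a ring of $S$-integers which is a PID in a number field containing the $2n$-th roots of unity, $p$ a prime with residue field of size $q\equiv1\bmod 2n$, $\psi$ additive of conductor $\mathfrak{o}_S$); $h^\flat(a)=1-v$ if $n\mid a$, else $0$; $g^\flat(a)=v\,g_a$. Gelfand–Tsetlin pattern of rank $s$, top row non-increasing $\kappa\in\mathbb{Z}^{s+1}$: integer array $(a_{ij})_{0\le i\le j\le s}$, top row $\kappa$, $a_{i-1,j-1}\ge a_{ij}\ge a_{i-1,j}$; $\Gamma_{ij}=\sum_{k'=j}^s(a_{ik'}-a_{i-1,k'})$; $\mathrm{wt}(\mathfrak{T})=(d_s,d_{s-1}-d_s,\dots,d_0-d_1)$ with $d_i=\sum_{j\ge i}a_{ij}$; $G^{(n,\kappa)}(\mathfrak{T})=\prod g_{ij}$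 with $g_{ij}=1$ if $a_{ij}=a_{i-1,j}<a_{i-1,j-1}$, $h^\flat(\Gamma_{ij})$ if $a_{i-1,j}<a_{ij}<a_{i-1,j-1}$, $g^\flat(\Gamma_{ij})$ if $a_{i-1,j}<a_{ij}=a_{i-1,j-1}$, $0$ if all three equal. Demazure crystal: with $b_{\binom{r-i+1}{2}+j-i+1}=\Gamma_{ij}$, $\mathcal{C}^{(w)}_{\lambda+\rho}$ is the set of rank $r$ patterns with top row $\lambda+\rho$ and $b_m=0$ for $m>\ell(w)=\binom r2+k+1$. -}

module Defs where

open import Level using (Level)
open import Data.Bool using (Bool; true; false; _∧_; _∨_; not; if_then_else_; T)
open import Data.Nat as ℕ using (ℕ; zero; suc; _∸_)
open import Data.Nat.Combinatorics using (_C_)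
open import Data.Nat.Divisibility using (_∣?_)
open import Data.Integer as ℤ using (ℤ; +_; _≤ᵇ_; ∣_∣)
open import Data.List using (List; []; _∷_; map; concatMap; upTo; filterᵇ; foldr; reverse; zipWith; drop; length; _++_)
open import Data.Vec as Vec using (Vec; toList)
open import Data.Product using (_×_; _,_)
open import Relation.Nullary using (does)
open import Algebra.Bundles using (CommutativeRing)

-- Integer-valued helpers (Boolean tests, so that finite sets can be
-- enumerated by filtering)

infix 4 _<ᶻ_ _==ᶻ_ _==ᴸ_

_<ᶻ_ : ℤ → ℤ → Bool
a <ᶻ b = (a ≤ᵇ b) ∧ not (b ≤ᵇ a)

_==ᶻ_ : ℤ → ℤ → Bool
a ==ᶻ b = (a ≤ᵇ b) ∧ (b ≤ᵇ a)

_==ᴸ_ : List ℤ → List ℤ → Bool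
[] ==ᴸ [] = true
(a ∷ as) ==ᴸ (b ∷ bs) = (a ==ᶻ b) ∧ (as ==ᴸ bs)
_ ==ᴸ _ = false

sumℤ : List ℤ → ℤ
sumℤ = foldr ℤ._+_ (+ 0)

-- 0-based list lookup (default 0; only used in range)
nth : List ℤ → ℕ → ℤ
nth [] _ = + 0
nth (a ∷ _) zero = a
nth (_ ∷ as) (suc i) = nth as i

allᵇ : {A : Set} → (A → Bool) → List A → Bool
allᵇ p = foldr (λ x b → p x ∧ b) true

oneTo : ℕ → List ℕ
oneTo m = map suc (upTo m)

nonIncr : List ℤ → Bool
nonIncr (a ∷ b ∷ as) = (b ≤ᵇ a) ∧ nonIncr (b ∷ as)
nonIncr _ = true

Dominant : ∀ {m} → Vec ℤ m → Set
Dominant lam = T (nonIncr (toList lam))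

rhoL : ℕ → List ℤ
rhoL m = map (λ i → + (m ∸ i)) (upTo (suc m))

w0 : List ℤ → List ℤ
w0 = reverse

negL : List ℤ → List ℤ
negL = map (λ a → ℤ.- a)

addL : List ℤ → List ℤ → List ℤ
addL = zipWith ℤ._+_

-- Gelfand–Tsetlin patterns of rank s, stored as the list of rows
-- row 0, row 1, ..., row s, where row i = (a_{i,i}, ..., a_{i,s}).

boxℤ : ℤ → ℤ → List ℤ
boxℤ lo hi = map (λ k → lo ℤ.+ + k) (upTo (suc ∣ hi ℤ.- lo ∣))

vecs : ℕ → List ℤ → List (List ℤ)
vecs zero b = [] ∷ []
vecs (suc m) b = concatMap (λ x → map (x ∷_) (vecs m b)) b

arrays : ℕ → List ℤ → List (List (List ℤ))
arrays zero b = [] ∷ []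
arrays (suc m) b = concatMap (λ row → map (row ∷_) (arrays m b)) (vecs (suc m) b)

-- interleaving of consecutive rows: u = row i-1, w = row i,
-- a_{i-1,j-1} ≥ a_{i,j} ≥ a_{i-1,j}
interleave : List ℤ → List ℤ → Bool
interleave (a ∷ []) [] = true
interleave (a ∷ b ∷ us) (c ∷ ws) = (c ≤ᵇ a) ∧ (b ≤ᵇ c) ∧ interleave (b ∷ us) ws
interleave _ _ = false

isPattern : List (List ℤ) → Bool
isPattern (u ∷ w ∷ rest) = interleave u w ∧ isPattern (w ∷ rest)
isPattern _ = true

-- Every entry of a pattern lies between min κ and max κ, so the box below
-- (which contains [min(0,κ), max(0,κ)]) contains all of them.
patterns : (s : ℕ) → List ℤ → List (List (List ℤ))
patterns s κ =
  filterᵇ isPattern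
    (map (κ ∷_) (arrays s (boxℤ (foldr ℤ._⊓_ (+ 0) κ) (foldr ℤ._⊔_ (+ 0) κ))))

-- Γ_{ij} = Σ_{k'=j}^{s} (a_{i k'} - a_{i-1,k'}), where u = (a_{i-1,j-1}, a_{i-1,j}, ...)
-- and w = (a_{i j}, a_{i,j+1}, ...)
Γ : List ℤ → List ℤ → ℤ
Γ [] w = + 0
Γ (_ ∷ us) w = sumℤ (zipWith ℤ._-_ w us)

-- weight: wt = (d_s, d_{s-1} - d_s, ..., d_0 - d_1), d_i = row sum of row i
diffs : List ℤ → List ℤ
diffs (x ∷ y ∷ rest) = (x ℤ.- y) ∷ diffs (y ∷ rest)
diffs l = l

wt : List (List ℤ) → List ℤ
wt rows = reverse (diffs (map sumℤ rows))

-- Demazure crystal condition: with b_{C(r-i+1,2)+j-i+1} = Γ_{ij},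
-- require b_m = 0 for all m > ℓ.

demRow : (base ℓ t : ℕ) → List ℤ → List ℤ → Bool
demRow base ℓ t (a ∷ b ∷ us) (c ∷ ws) =
  (if ℓ ℕ.<ᵇ (base ℕ.+ t ℕ.+ 1) then Γ (a ∷ b ∷ us) (c ∷ ws) ==ᶻ + 0 else true)
  ∧ demRow base ℓ (suc t) (b ∷ us) ws
demRow _ _ _ _ _ = true

-- i = index of the lower row w; t = j - i
demAll : (r ℓ i : ℕ) → List (List ℤ) → Bool
demAll r ℓ i (u ∷ w ∷ rest) = demRow (suc (r ∸ i) C 2) ℓ 0 u w ∧ demAll r ℓ (suc i) (w ∷ rest)
demAll _ _ _ _ = true

-- ℓ(w) for w = w₀^{(r-1)} σ_r ⋯ σ_{r-k}
lengthW : (r k : ℕ) → ℕ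
lengthW r k = (r C 2) ℕ.+ k ℕ.+ 1

demazure : (r k : ℕ) → List ℤ → List (List (List ℤ))
demazure r k κ = filterᵇ (demAll r (lengthW r k) 1) (patterns r κ)

-- Weights G^{(n,κ)} and the identity, over a commutative ring R with
-- parameters v and Gauss sums g : ℤ → R (abstract).

module Gen {c ℓ : Level} (R : CommutativeRing c ℓ) (v : CommutativeRing.Carrier R)
           (g : ℤ → CommutativeRing.Carrier R) (n : ℕ) where
  open CommutativeRing R

  h♭ : ℤ → Carrier
  h♭ a = if does (n ∣? ∣ a ∣) then 1# - v else 0#

  g♭ : ℤ → Carrier
  g♭ a = v * g a

  -- factor g_{ij}, with a = a_{i-1,j-1}, b = a_{i-1,j}, x = a_{ij}, γ = Γ_{ij}
  gfac : ℤ → ℤ → ℤ → ℤ → Carrier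
  gfac a b x γ =
    if (b ==ᶻ x) ∧ (x <ᶻ a) then 1#
    else if (b <ᶻ x) ∧ (x <ᶻ a) then h♭ γ
    else if (b <ᶻ x) ∧ (x ==ᶻ a) then g♭ γ
    else 0#

  rowFactor : List ℤ → List ℤ → Carrier
  rowFactor (a ∷ b ∷ us) (x ∷ ws) = gfac a b x (Γ (a ∷ b ∷ us) (x ∷ ws)) * rowFactor (b ∷ us) ws
  rowFactor _ _ = 1#

  G : List (List ℤ) → Carrier
  G (u ∷ w ∷ rest) = rowFactor u w * G (w ∷ rest)
  G _ = 1#

  sumR : List Carrier → Carrier
  sumR = foldr _+_ 0#

  -- Laurent polynomials: finite formal sums of terms c · x^e
  Laurent : Set c
  Laurent = List (Carrier × List ℤ)

  coeff : List ℤ → Laurent → Carrier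
  coeff ν p = sumR (map (λ { (a , e) → if e ==ᴸ ν then a else 0# }) p)

  module _ (r k : ℕ) (lam : Vec ℤ (suc r)) where
    λρ : List ℤ
    λρ = addL (toList lam) (rhoL r)

    LHS : Laurent
    LHS = map (λ T → G T , addL (wt T) (negL (w0 (rhoL r)))) (demazure r k λρ)

    goodμ : List ℤ → Bool
    goodμ μ = interleave λρ μ
            ∧ allᵇ (λ j → not (suc k ℕ.<ᵇ j) ∨ (nth μ (j ∸ 1) ==ᶻ (nth (toList lam) j ℤ.+ + (r ∸ j))))
                  (oneTo r)

    μs : List (List ℤ)
    μs = filterᵇ goodμ (vecs r (boxℤ (foldr ℤ._⊓_ (+ 0) λρ) (foldr ℤ._⊔_ (+ 0) λρ)))

    Tstar : List ℤ → List (List ℤ)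
    Tstar μ = λρ ∷ map (λ i → drop i μ) (upTo r)

    RHS : Laurent
    RHS = concatMap
      (λ μ → map (λ T' → (G (Tstar μ) * G T') ,
                          (addL (wt T') (negL (w0 (rhoL (r ∸ 1))))
                           ++ ((sumℤ λρ ℤ.- sumℤ μ ℤ.- + r) ∷ [])))
                 (patterns (r ∸ 1) μ))
      μs

{-# OPTIONS --safe #-}
-- Write κ = λ + ρ. Both sides are sums over rank r patterns κ ∷ μ ∷ rows, grouped by their second row μ.
-- As ℓ(w) = C(r,2) + k + 1, the Demazure condition b_m = 0 (m > ℓ(w)) does not constrain rows 2, …, r;
-- on row 1 it asks that the suffix sums Γ_{1j}, j > k + 1, of the differences μ_j − κ_{j+1} vanish, which
-- happens iff the differences themselves vanish, i.e. iff μ_j = λ_{j+1} + r − j: the restriction on μ.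
-- For fixed μ, G^{(n,κ)} is the row-1 factor times G^{(n,μ)}(μ ∷ rows), and this row-1 factor is the weight
-- of the lowest pattern 𝔗_*^μ: its lower rows contribute 1 when μ is strictly decreasing, and otherwise
-- every pattern of positive rank with top row μ has weight 0. The weight vector splits off its last
-- coordinate d(κ) − d(μ), and ρ splits off r. Finally the candidate entries are enumerated from integer
-- boxes; since the entries of a pattern lie between the extremes of its top row, the box attached to κ can
-- be shrunk to the one attached to μ.
module Submission where

open import Defs
open import Function using (_∘_; id; _⇔_; mk⇔; Equivalence)
open import Function.Properties.Equivalence using (⇔-setoid) renaming (trans to ⇔-trans)
open import Level using (Level; 0ℓ)
open import Algebra.Bundles using (CommutativeRing)
open import Data.Bool using (Bool; true; false; _∧_; _∨_; not; if_then_else_; T)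
open import Data.Bool.Properties using (∧-identityʳ)
open import Data.Unit using (tt)
open import Data.Empty using (⊥-elim)
open import Data.Nat as ℕ using (ℕ; zero; suc; pred; z≤n; s≤s; _≤_; _<_; _∸_)
import Data.Nat.Properties as ℕP
open import Data.Nat.Combinatorics using (_C_; nC1≡n; nCk+nC[k+1]≡[n+1]C[k+1])
open import Data.Nat.Tactic.RingSolver as ℕSolver using ()
open import Data.Integer as ℤ using (ℤ; +_; ∣_∣; _≤ᵇ_)
import Data.Integer.Properties as ℤP
open import Data.Integer.Tactic.RingSolver using (solve-∀)
open import Data.List
  using (List; []; _∷_; _++_; _∷ʳ_; map; concatMap; applyUpTo; upTo; foldr; length; drop; zipWith; reverse; filterᵇ)
import Data.List.Properties as List
open import Data.List.Relation.Unary.All as All using (All; []; _∷_)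
open import Data.Vec using (Vec; toList)
import Data.Vec.Properties as Vec
import Data.List.Relation.Unary.All.Properties as All
open import Data.Product using (_×_; _,_; proj₁; proj₂; ∃₂)
open import Relation.Nullary using (¬_; yes; no)
open import Relation.Binary.PropositionalEquality
  using (_≡_; refl; sym; trans; cong; cong₂; subst; module ≡-Reasoning)

∧-true⁻ : ∀ {a b} → a ∧ b ≡ true → a ≡ true × b ≡ true
∧-true⁻ {true} {true} _ = refl , refl

∧-true⁺ : ∀ {a b} → a ≡ true → b ≡ true → a ∧ b ≡ true
∧-true⁺ refl refl = refl

T⇒≡true : ∀ {b} → T b → b ≡ true
T⇒≡true {true} _ = refl

≡true⇒T : ∀ {b} → b ≡ true → T b
≡true⇒T refl = tt

≡true-ext : ∀ {a b} → (a ≡ true ⇔ b ≡ true) → a ≡ b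
≡true-ext {false} {false} _ = refl
≡true-ext {false} {true}  a⇔b = Equivalence.from a⇔b refl
≡true-ext {true}  {false} a⇔b = sym (Equivalence.to a⇔b refl)
≡true-ext {true}  {true}  _ = refl

≤ᵇ-refl : ∀ a → (a ≤ᵇ a) ≡ true
≤ᵇ-refl a = T⇒≡true (ℤP.≤⇒≤ᵇ {a} {a} ℤP.≤-refl)

≤ᵇ≡true⇒≤ : ∀ {a b} → (a ≤ᵇ b) ≡ true → a ℤ.≤ b
≤ᵇ≡true⇒≤ = ℤP.≤ᵇ⇒≤ ∘ ≡true⇒T

==ᶻ⇒≡ : ∀ {a b} → (a ==ᶻ b) ≡ true → a ≡ b
==ᶻ⇒≡ eq = let a≤b , b≤a = ∧-true⁻ eq in
  ℤP.≤-antisym (≤ᵇ≡true⇒≤ a≤b) (≤ᵇ≡true⇒≤ b≤a)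

<ᶻ≡false⇒≥ : ∀ {a b} → b ℤ.≤ a → (b <ᶻ a) ≡ false → a ℤ.≤ b
<ᶻ≡false⇒≥ {a} {b} b≤a b≮a rewrite T⇒≡true (ℤP.≤⇒≤ᵇ b≤a) with a ≤ᵇ b in a≤b
... | true = ≤ᵇ≡true⇒≤ a≤b

≡⇒==ᶻ : ∀ {a b} → a ≡ b → (a ==ᶻ b) ≡ true
≡⇒==ᶻ {a} refl rewrite ≤ᵇ-refl a = refl

allᵇ⇔All : ∀ {A : Set} (p : A → Bool) xs → allᵇ p xs ≡ true ⇔ All (λ x → p x ≡ true) xs
allᵇ⇔All p xs = mk⇔ (to xs) (from xs)
  where
  to : ∀ xs → allᵇ p xs ≡ true → All (λ x → p x ≡ true) xs
  to []       _  = []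
  to (x ∷ xs) eq = let px , pxs = ∧-true⁻ eq in px ∷ to xs pxs
  from : ∀ xs → All (λ x → p x ≡ true) xs → allᵇ p xs ≡ true
  from []       []         = refl
  from (x ∷ xs) (px ∷ pxs) = ∧-true⁺ px (from xs pxs)

-- Integer intervals

applyUpTo-cong : ∀ {A : Set} {f g : ℕ → A} → (∀ k → f k ≡ g k) →
                 ∀ n → applyUpTo f n ≡ applyUpTo g n
applyUpTo-cong f≗g zero    = refl
applyUpTo-cong f≗g (suc n) = cong₂ _∷_ (f≗g 0) (applyUpTo-cong (f≗g ∘ suc) n)

applyUpTo-++ : ∀ {A : Set} (f : ℕ → A) m n →
               applyUpTo f (m ℕ.+ n) ≡ applyUpTo f m ++ applyUpTo (f ∘ (m ℕ.+_)) n
applyUpTo-++ f zero    n = refl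
applyUpTo-++ f (suc m) n = cong (f 0 ∷_) (applyUpTo-++ (f ∘ suc) m n)

+∣j-i∣≡j-i : ∀ {i j} → i ℤ.≤ j → + ∣ j ℤ.- i ∣ ≡ j ℤ.- i
+∣j-i∣≡j-i = ℤP.0≤i⇒+∣i∣≡i ∘ ℤP.i≤j⇒0≤j-i

i<i+[1+n] : ∀ i n → i ℤ.< i ℤ.+ + suc n
i<i+[1+n] i n = subst (ℤ._< i ℤ.+ + suc n) (ℤP.+-identityʳ i) (ℤP.+-monoʳ-< i (ℤ.+<+ (s≤s z≤n)))

boxℤ-split : ∀ {lo lo' hi' hi} → lo ℤ.≤ lo' → lo' ℤ.≤ hi' → hi' ℤ.≤ hi →
  ∃₂ λ xs ys → boxℤ lo hi ≡ xs ++ boxℤ lo' hi' ++ ys × All (ℤ._< lo') xs × All (hi' ℤ.<_) ys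
boxℤ-split {lo} {lo'} {hi'} {hi} lo≤lo' lo'≤hi' hi'≤hi =
  applyUpTo f p , applyUpTo (λ k → hi' ℤ.+ + suc k) q , split , below , above
  where
  open ≡-Reasoning
  cancel : ∀ a b → a ℤ.+ (b ℤ.- a) ≡ b
  cancel = solve-∀
  telescope : ∀ lo lo' hi' hi →
    + 1 ℤ.+ (hi ℤ.- lo) ≡ (lo' ℤ.- lo) ℤ.+ ((+ 1 ℤ.+ (hi' ℤ.- lo')) ℤ.+ (hi ℤ.- hi'))
  telescope = solve-∀
  telescope-top : ∀ lo lo' hi' k →
    lo ℤ.+ ((lo' ℤ.- lo) ℤ.+ ((+ 1 ℤ.+ (hi' ℤ.- lo')) ℤ.+ k)) ≡ hi' ℤ.+ (+ 1 ℤ.+ k)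
  telescope-top = solve-∀
  f : ℕ → ℤ
  f k = lo ℤ.+ + k
  p = ∣ lo' ℤ.- lo ∣
  m = suc ∣ hi' ℤ.- lo' ∣
  q = ∣ hi ℤ.- hi' ∣
  p≡ : + p ≡ lo' ℤ.- lo
  p≡ = +∣j-i∣≡j-i lo≤lo'
  m≡ : + m ≡ + 1 ℤ.+ (hi' ℤ.- lo')
  m≡ = cong (λ z → + 1 ℤ.+ z) (+∣j-i∣≡j-i lo'≤hi')
  lo+p≡lo' : lo ℤ.+ + p ≡ lo'
  lo+p≡lo' = trans (cong (λ z → lo ℤ.+ z) p≡) (cancel lo lo')

  length-split : suc ∣ hi ℤ.- lo ∣ ≡ p ℕ.+ (m ℕ.+ q)
  length-split = ℤP.+-injective (begin
    + 1 ℤ.+ + ∣ hi ℤ.- lo ∣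
      ≡⟨ cong (λ z → + 1 ℤ.+ z) (+∣j-i∣≡j-i (ℤP.≤-trans lo≤lo' (ℤP.≤-trans lo'≤hi' hi'≤hi))) ⟩
    + 1 ℤ.+ (hi ℤ.- lo)
      ≡⟨ telescope lo lo' hi' hi ⟩
    (lo' ℤ.- lo) ℤ.+ ((+ 1 ℤ.+ (hi' ℤ.- lo')) ℤ.+ (hi ℤ.- hi'))
      ≡⟨ cong₂ (λ a b → a ℤ.+ (b ℤ.+ (hi ℤ.- hi'))) p≡ m≡ ⟨
    + p ℤ.+ (+ m ℤ.+ (hi ℤ.- hi'))
      ≡⟨ cong (λ c → + p ℤ.+ (+ m ℤ.+ c)) (+∣j-i∣≡j-i hi'≤hi) ⟨
    + (p ℕ.+ (m ℕ.+ q)) ∎)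

  middle : applyUpTo (f ∘ (p ℕ.+_)) m ≡ boxℤ lo' hi'
  middle = sym (trans (List.map-upTo (λ k → lo' ℤ.+ + k) m) (applyUpTo-cong (λ k → begin
    lo' ℤ.+ + k             ≡⟨ cong (ℤ._+ + k) lo+p≡lo' ⟨
    (lo ℤ.+ + p) ℤ.+ + k    ≡⟨ ℤP.+-assoc lo (+ p) (+ k) ⟩
    lo ℤ.+ + (p ℕ.+ k)      ∎) m))

  top : ∀ k → f (p ℕ.+ (m ℕ.+ k)) ≡ hi' ℤ.+ + suc k
  top k = begin
    lo ℤ.+ (+ p ℤ.+ (+ m ℤ.+ + k))
      ≡⟨ cong₂ (λ a b → lo ℤ.+ (a ℤ.+ (b ℤ.+ + k))) p≡ m≡ ⟩
    lo ℤ.+ ((lo' ℤ.- lo) ℤ.+ ((+ 1 ℤ.+ (hi' ℤ.- lo')) ℤ.+ + k))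
      ≡⟨ telescope-top lo lo' hi' (+ k) ⟩
    hi' ℤ.+ + suc k ∎

  split : boxℤ lo hi ≡ applyUpTo f p ++ boxℤ lo' hi' ++ applyUpTo (λ k → hi' ℤ.+ + suc k) q
  split = begin
    boxℤ lo hi
      ≡⟨ List.map-upTo f (suc ∣ hi ℤ.- lo ∣) ⟩
    applyUpTo f (suc ∣ hi ℤ.- lo ∣)
      ≡⟨ cong (applyUpTo f) length-split ⟩
    applyUpTo f (p ℕ.+ (m ℕ.+ q))
      ≡⟨ applyUpTo-++ f p (m ℕ.+ q) ⟩
    applyUpTo f p ++ applyUpTo (f ∘ (p ℕ.+_)) (m ℕ.+ q)
      ≡⟨ cong (applyUpTo f p ++_) (applyUpTo-++ (f ∘ (p ℕ.+_)) m q) ⟩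
    applyUpTo f p ++ applyUpTo (f ∘ (p ℕ.+_)) m ++ applyUpTo (λ k → f (p ℕ.+ (m ℕ.+ k))) q
      ≡⟨ cong₂ (λ xs ys → applyUpTo f p ++ xs ++ ys) middle (applyUpTo-cong top q) ⟩
    applyUpTo f p ++ boxℤ lo' hi' ++ applyUpTo (λ k → hi' ℤ.+ + suc k) q ∎

  below : All (ℤ._< lo') (applyUpTo f p)
  below = All.applyUpTo⁺₁ f p (λ i<p → subst (f _ ℤ.<_) lo+p≡lo' (ℤP.+-monoʳ-< lo (ℤ.+<+ i<p)))

  above : All (hi' ℤ.<_) (applyUpTo (λ k → hi' ℤ.+ + suc k) q)
  above = All.applyUpTo⁺₂ _ q (i<i+[1+n] hi')

-- Bounds on the entries of a pattern

lower upper : List ℤ → ℤ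
lower = foldr ℤ._⊓_ (+ 0)
upper = foldr ℤ._⊔_ (+ 0)

Within : ℤ → ℤ → ℤ → Set
Within lo hi x = lo ℤ.≤ x × x ℤ.≤ hi

lower≤0 : ∀ u → lower u ℤ.≤ + 0
lower≤0 []      = ℤP.≤-refl
lower≤0 (a ∷ u) = ℤP.≤-trans (ℤP.i⊓j≤j a (lower u)) (lower≤0 u)

0≤upper : ∀ u → + 0 ℤ.≤ upper u
0≤upper []      = ℤP.≤-refl
0≤upper (a ∷ u) = ℤP.≤-trans (0≤upper u) (ℤP.i≤j⊔i a (upper u))

lower≤upper : ∀ u → lower u ℤ.≤ upper u
lower≤upper u = ℤP.≤-trans (lower≤0 u) (0≤upper u)

All-Within⇒lower≤lower : ∀ {lo hi} u → lo ℤ.≤ + 0 → All (Within lo hi) u → lo ℤ.≤ lower u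
All-Within⇒lower≤lower []      lo≤0 []             = lo≤0
All-Within⇒lower≤lower (a ∷ u) lo≤0 ((lo≤a , _) ∷ w) =
  ℤP.⊓-glb lo≤a (All-Within⇒lower≤lower u lo≤0 w)

All-Within⇒upper≤upper : ∀ {lo hi} u → + 0 ℤ.≤ hi → All (Within lo hi) u → upper u ℤ.≤ hi
All-Within⇒upper≤upper []      0≤hi []             = 0≤hi
All-Within⇒upper≤upper (a ∷ u) 0≤hi ((_ , a≤hi) ∷ w) =
  ℤP.⊔-lub a≤hi (All-Within⇒upper≤upper u 0≤hi w)

¬Within-below : ∀ {lo hi x} → x ℤ.< lo → ¬ Within lo hi x
¬Within-below x<lo (lo≤x , _) = ℤP.<⇒≱ x<lo lo≤x

¬Within-above : ∀ {lo hi x} → hi ℤ.< x → ¬ Within lo hi x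
¬Within-above hi<x (_ , x≤hi) = ℤP.<⇒≱ hi<x x≤hi

Within-weaken : ∀ {lo hi lo' hi'} → lo ℤ.≤ lo' → hi' ℤ.≤ hi →
                ∀ {x} → Within lo' hi' x → Within lo hi x
Within-weaken lo≤lo' hi'≤hi (lo'≤x , x≤hi') =
  ℤP.≤-trans lo≤lo' lo'≤x , ℤP.≤-trans x≤hi' hi'≤hi

interleave-∷⁻ : ∀ a b c us ws → interleave (a ∷ b ∷ us) (c ∷ ws) ≡ true →
                c ℤ.≤ a × b ℤ.≤ c × interleave (b ∷ us) ws ≡ true
interleave-∷⁻ a b c us ws eq with ∧-true⁻ {c ≤ᵇ a} eq
... | c≤a , rest with ∧-true⁻ {b ≤ᵇ c} rest
... | b≤c , tail = ≤ᵇ≡true⇒≤ c≤a , ≤ᵇ≡true⇒≤ b≤c , tail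

interleave⇒Within : ∀ u w → interleave u w ≡ true → All (Within (lower u) (upper u)) w
interleave⇒Within (a ∷ [])     []       _  = []
interleave⇒Within (a ∷ b ∷ us) (c ∷ ws) eq =
  let c≤a , b≤c , tail = interleave-∷⁻ a b c us ws eq in
  ( ℤP.≤-trans (ℤP.i⊓j≤j a _) (ℤP.≤-trans (ℤP.i⊓j≤i b _) b≤c)
  , ℤP.≤-trans c≤a (ℤP.i≤i⊔j a _))
  ∷ All.map (Within-weaken (ℤP.i⊓j≤j a _) (ℤP.i≤j⊔i a _)) (interleave⇒Within (b ∷ us) ws tail)

isPattern⇒Within : ∀ u rows → isPattern (u ∷ rows) ≡ true →
                   All (All (Within (lower u) (upper u))) rows
isPattern⇒Within u []         _  = []
isPattern⇒Within u (w ∷ rows) eq =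
  w-within ∷ All.map (All.map (Within-weaken lower-mono upper-mono)) (isPattern⇒Within w rows rows-pattern)
  where
  u-w = proj₁ (∧-true⁻ eq)
  rows-pattern = proj₂ (∧-true⁻ eq)
  w-within = interleave⇒Within u w u-w
  lower-mono = All-Within⇒lower≤lower w (lower≤0 u) w-within
  upper-mono = All-Within⇒upper≤upper w (0≤upper u) w-within

data Triangular : ℕ → List (List ℤ) → Set where
  []  : Triangular 0 []
  _∷_ : ∀ {m row rows} → length row ≡ suc m → Triangular m rows → Triangular (suc m) (row ∷ rows)

Triangular-length : ∀ {m rows} → Triangular m rows → length rows ≡ m
Triangular-length []       = refl
Triangular-length (_ ∷ sh) = cong suc (Triangular-length sh)

vecs-length : ∀ m b → All (λ xs → length xs ≡ m) (vecs m b)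
vecs-length zero    b = refl ∷ []
vecs-length (suc m) b =
  All.concat⁺ (All.map⁺ (All.universal (λ x → All.map⁺ (All.map (cong suc) (vecs-length m b))) b))

arrays-triangular : ∀ m b → All (Triangular m) (arrays m b)
arrays-triangular zero    b = [] ∷ []
arrays-triangular (suc m) b =
  All.concat⁺ (All.map⁺ (All.map (λ len → All.map⁺ (All.map (len ∷_) (arrays-triangular m b)))
                                 (vecs-length (suc m) b)))

-- The Demazure condition

if-else-true⇔ : ∀ c x → (if c then x else true) ≡ true ⇔ (c ≡ true → x ≡ true)
if-else-true⇔ true  x = mk⇔ (λ x≡true _ → x≡true) (λ f → f refl)
if-else-true⇔ false x = mk⇔ (λ _ ()) (λ _ → refl)

not∨⇔ : ∀ c x → (not c ∨ x) ≡ true ⇔ (c ≡ true → x ≡ true)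
not∨⇔ true  = if-else-true⇔ true
not∨⇔ false = if-else-true⇔ false

<⇒<ᵇ≡true : ∀ {m n} → m < n → (m ℕ.<ᵇ n) ≡ true
<⇒<ᵇ≡true = T⇒≡true ∘ ℕP.<⇒<ᵇ

<ᵇ≡true⇒< : ∀ {m n} → (m ℕ.<ᵇ n) ≡ true → m < n
<ᵇ≡true⇒< = ℕP.<ᵇ⇒< _ _ ∘ ≡true⇒T

≤⇒<ᵇ≡false : ∀ {m n} → m ≤ n → (n ℕ.<ᵇ m) ≡ false
≤⇒<ᵇ≡false {m} {n} m≤n with n ℕ.<ᵇ m in eq
... | false = refl
... | true  = ⊥-elim (ℕP.<⇒≱ (<ᵇ≡true⇒< eq) m≤n)

<ᵇ-cancelˡ : ∀ b k t → (b ℕ.+ k ℕ.<ᵇ b ℕ.+ t) ≡ (k ℕ.<ᵇ t)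
<ᵇ-cancelˡ zero    k t = refl
<ᵇ-cancelˡ (suc b) k t = <ᵇ-cancelˡ b k t

<ᵇ-cancelˡ-+1 : ∀ b k t → (b ℕ.+ k ℕ.+ 1 ℕ.<ᵇ b ℕ.+ t ℕ.+ 1) ≡ (k ℕ.<ᵇ t)
<ᵇ-cancelˡ-+1 b k t rewrite ℕP.+-comm (b ℕ.+ k) 1 | ℕP.+-comm (b ℕ.+ t) 1 = <ᵇ-cancelˡ b k t

nC2+n≡[1+n]C2 : ∀ d → d C 2 ℕ.+ d ≡ suc d C 2
nC2+n≡[1+n]C2 d = begin
  d C 2 ℕ.+ d       ≡⟨ ℕP.+-comm (d C 2) d ⟩
  d ℕ.+ d C 2       ≡⟨ cong (ℕ._+ d C 2) (nC1≡n d) ⟨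
  d C 1 ℕ.+ d C 2   ≡⟨ nCk+nC[k+1]≡[n+1]C[k+1] d 1 ⟩
  suc d C 2         ∎
  where open ≡-Reasoning

demRow-vacuous : ∀ base ℓ t u w → base ℕ.+ t ℕ.+ length w ≤ ℓ → demRow base ℓ t u w ≡ true
demRow-vacuous base ℓ t (a ∷ b ∷ us) (c ∷ ws) bound
  rewrite ≤⇒<ᵇ≡false (ℕP.≤-trans (ℕP.+-monoʳ-≤ (base ℕ.+ t) (s≤s z≤n)) bound) =
  demRow-vacuous base ℓ (suc t) (b ∷ us) ws (subst (_≤ ℓ) (shift base t (length ws)) bound)
  where
  shift : ∀ b t l → b ℕ.+ t ℕ.+ suc l ≡ b ℕ.+ suc t ℕ.+ l
  shift = ℕSolver.solve-∀
demRow-vacuous base ℓ t []          w        _ = refl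
demRow-vacuous base ℓ t (a ∷ [])    w        _ = refl
demRow-vacuous base ℓ t (a ∷ _ ∷ _) []       _ = refl

demAll-vacuous : ∀ r ℓ i d u rows → Triangular d rows → r ∸ i ≡ pred d → suc d C 2 ≤ ℓ →
                 demAll r ℓ i (u ∷ rows) ≡ true
demAll-vacuous r ℓ i zero    u []         []            _ _ = refl
demAll-vacuous r ℓ i (suc d) u (w ∷ rows) (len ∷ shape) r∸i≡d bound =
  ∧-true⁺ (subst (λ e → demRow (suc e C 2) ℓ 0 u w ≡ true) (sym r∸i≡d)
                 (demRow-vacuous (suc d C 2) ℓ 0 u w (subst (_≤ ℓ) (sym row-size) bound)))
          (demAll-vacuous r ℓ (suc i) d w rows shape
            (trans (sym (ℕP.pred[m∸n]≡m∸[1+n] r i)) (cong pred r∸i≡d))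
            (ℕP.≤-trans (ℕP.m≤m+n (suc d C 2) (suc d)) (subst (_≤ ℓ) (sym (nC2+n≡[1+n]C2 (suc d))) bound)))
  where
  row-size : suc d C 2 ℕ.+ 0 ℕ.+ length w ≡ suc (suc d) C 2
  row-size = trans (cong₂ ℕ._+_ (ℕP.+-identityʳ (suc d C 2)) len) (nC2+n≡[1+n]C2 (suc d))

suffixSum : List ℤ → ℕ → ℤ
suffixSum D s = sumℤ (drop s D)

suffixSum-[] : ∀ s → suffixSum [] s ≡ + 0
suffixSum-[] s = cong sumℤ (List.drop-[] s)

suffixSum-step : ∀ D s → suffixSum D s ≡ nth D s ℤ.+ suffixSum D (suc s)
suffixSum-step []      zero    = refl
suffixSum-step []      (suc s) = refl
suffixSum-step (d ∷ D) zero    = refl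
suffixSum-step (d ∷ D) (suc s) = suffixSum-step D s

entries-vanish⇒suffixSum-vanishes : ∀ D s → (∀ s' → s ≤ s' → nth D s' ≡ + 0) →
                                    suffixSum D s ≡ + 0
entries-vanish⇒suffixSum-vanishes []      s       _      = suffixSum-[] s
entries-vanish⇒suffixSum-vanishes (d ∷ D) zero    vanish =
  cong₂ ℤ._+_ (vanish 0 z≤n) (entries-vanish⇒suffixSum-vanishes D 0 (λ s' _ → vanish (suc s') z≤n))
entries-vanish⇒suffixSum-vanishes (d ∷ D) (suc s) vanish =
  entries-vanish⇒suffixSum-vanishes D s (λ s' s≤s' → vanish (suc s') (s≤s s≤s'))

suffixSums-vanish⇔entries-vanish : ∀ k D →
  (∀ s → k < s → suffixSum D s ≡ + 0) ⇔ (∀ s → k < s → nth D s ≡ + 0)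
suffixSums-vanish⇔entries-vanish k D = mk⇔ to from
  where
  to : (∀ s → k < s → suffixSum D s ≡ + 0) → ∀ s → k < s → nth D s ≡ + 0
  to sums s k<s = begin
    nth D s                            ≡⟨ ℤP.+-identityʳ (nth D s) ⟨
    nth D s ℤ.+ + 0                    ≡⟨ cong (λ z → nth D s ℤ.+ z) (sums (suc s) (ℕP.m<n⇒m<1+n k<s)) ⟨
    nth D s ℤ.+ suffixSum D (suc s)    ≡⟨ suffixSum-step D s ⟨
    suffixSum D s                      ≡⟨ sums s k<s ⟩
    + 0                                ∎
    where open ≡-Reasoning
  from : (∀ s → k < s → nth D s ≡ + 0) → ∀ s → k < s → suffixSum D s ≡ + 0
  from entries s k<s =
    entries-vanish⇒suffixSum-vanishes D s (λ s' s≤s' → entries s' (ℕP.<-≤-trans k<s s≤s'))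

demRow⇒suffixSums : ∀ b k t u w → length u ≡ suc (length w) →
                    demRow b (b ℕ.+ k ℕ.+ 1) t u w ≡ true →
                    ∀ s → k < t ℕ.+ s → suffixSum (zipWith ℤ._-_ w (drop 1 u)) s ≡ + 0
demRow⇒suffixSums b k t (a ∷ a' ∷ us) (c ∷ ws) len eq zero k<t =
  ==ᶻ⇒≡ (Equivalence.to (if-else-true⇔ (k ℕ.<ᵇ t) _) head (<⇒<ᵇ≡true (subst (k <_) (ℕP.+-identityʳ t) k<t)))
  where
  head : (if k ℕ.<ᵇ t then Γ (a ∷ a' ∷ us) (c ∷ ws) ==ᶻ + 0 else true) ≡ true
  head = subst (λ e → (if e then Γ (a ∷ a' ∷ us) (c ∷ ws) ==ᶻ + 0 else true) ≡ true)
               (<ᵇ-cancelˡ-+1 b k t) (proj₁ (∧-true⁻ eq))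
demRow⇒suffixSums b k t (a ∷ a' ∷ us) (c ∷ ws) len eq (suc s) k<t =
  demRow⇒suffixSums b k (suc t) (a' ∷ us) ws (ℕP.suc-injective len) (proj₂ (∧-true⁻ eq)) s
    (subst (k <_) (ℕP.+-suc t s) k<t)
demRow⇒suffixSums b k t (a ∷ []) [] _ _ s _ = suffixSum-[] s

suffixSums⇒demRow : ∀ b k t u w → length u ≡ suc (length w) →
                    (∀ s → k < t ℕ.+ s → suffixSum (zipWith ℤ._-_ w (drop 1 u)) s ≡ + 0) →
                    demRow b (b ℕ.+ k ℕ.+ 1) t u w ≡ true
suffixSums⇒demRow b k t (a ∷ a' ∷ us) (c ∷ ws) len sums =
  ∧-true⁺ (subst (λ e → (if e then Γ (a ∷ a' ∷ us) (c ∷ ws) ==ᶻ + 0 else true) ≡ true)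
                 (sym (<ᵇ-cancelˡ-+1 b k t)) (Equivalence.from (if-else-true⇔ (k ℕ.<ᵇ t) _) head))
          (suffixSums⇒demRow b k (suc t) (a' ∷ us) ws (ℕP.suc-injective len)
             (λ s k<t+s → sums (suc s) (subst (k <_) (sym (ℕP.+-suc t s)) k<t+s)))
  where
  head : (k ℕ.<ᵇ t) ≡ true → (Γ (a ∷ a' ∷ us) (c ∷ ws) ==ᶻ + 0) ≡ true
  head k<ᵇt = ≡⇒==ᶻ (sums 0 (subst (k <_) (sym (ℕP.+-identityʳ t)) (<ᵇ≡true⇒< k<ᵇt)))
suffixSums⇒demRow b k t (a ∷ []) [] _ _ = refl

nth-beyond : ∀ xs s → length xs ≤ s → nth xs s ≡ + 0
nth-beyond []       s       _         = refl
nth-beyond (x ∷ xs) (suc s) (s≤s len) = nth-beyond xs s len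

nth-drop1 : ∀ u s → nth (drop 1 u) s ≡ nth u (suc s)
nth-drop1 []      s = refl
nth-drop1 (a ∷ u) s = refl

nth-zipWith : ∀ (f : ℤ → ℤ → ℤ) → f (+ 0) (+ 0) ≡ + 0 → ∀ xs ys → length xs ≡ length ys →
              ∀ s → nth (zipWith f xs ys) s ≡ f (nth xs s) (nth ys s)
nth-zipWith f f00 []       []       _   s       = sym f00
nth-zipWith f f00 (x ∷ xs) (y ∷ ys) _   zero    = refl
nth-zipWith f f00 (x ∷ xs) (y ∷ ys) len (suc s) = nth-zipWith f f00 xs ys (ℕP.suc-injective len) s

rhoL-suc : ∀ m → rhoL (suc m) ≡ + suc m ∷ rhoL m
rhoL-suc m = cong (+ suc m ∷_) (trans (List.map-applyUpTo suc (λ i → + (suc m ∸ i)) (suc m))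
                                      (sym (List.map-applyUpTo id (λ i → + (m ∸ i)) (suc m))))

length-rhoL : ∀ m → length (rhoL m) ≡ suc m
length-rhoL m = trans (List.length-map (λ i → + (m ∸ i)) (upTo (suc m))) (List.length-upTo (suc m))

nth-rhoL : ∀ m j → nth (rhoL m) j ≡ + (m ∸ j)
nth-rhoL zero    zero    = refl
nth-rhoL zero    (suc j) = refl
nth-rhoL (suc m) j rewrite rhoL-suc m with j
... | zero  = refl
... | suc j = nth-rhoL m j

topRow : (r : ℕ) → Vec ℤ (suc r) → List ℤ
topRow r lam = addL (toList lam) (rhoL r)

length-topRow : ∀ r lam → length (topRow r lam) ≡ suc r
length-topRow r lam = begin
  length (topRow r lam)                    ≡⟨ List.length-zipWith ℤ._+_ (toList lam) (rhoL r) ⟩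
  length (toList lam) ℕ.⊓ length (rhoL r)  ≡⟨ cong₂ ℕ._⊓_ (Vec.length-toList lam) (length-rhoL r) ⟩
  suc r ℕ.⊓ suc r                          ≡⟨ ℕP.⊓-idem (suc r) ⟩
  suc r                                    ∎
  where open ≡-Reasoning

nth-topRow : ∀ r lam j → nth (topRow r lam) j ≡ nth (toList lam) j ℤ.+ + (r ∸ j)
nth-topRow r lam j =
  trans (nth-zipWith ℤ._+_ refl (toList lam) (rhoL r) (trans (Vec.length-toList lam) (sym (length-rhoL r))) j)
        (cong (λ z → nth (toList lam) j ℤ.+ z) (nth-rhoL r j))

tailFixed : (r k : ℕ) → Vec ℤ (suc r) → List ℤ → Bool
tailFixed r k lam μ =
  allᵇ (λ j → not (suc k ℕ.<ᵇ j) ∨ (nth μ (j ∸ 1) ==ᶻ (nth (toList lam) j ℤ.+ + (r ∸ j)))) (oneTo r)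

-- Indices are 0-based: this is the paper's μ_j = κ_{j+1} for j > k + 1.
TailAgrees : ℕ → List ℤ → List ℤ → Set
TailAgrees k μ κ = ∀ s → k < s → nth μ s ≡ nth κ (suc s)

tailFixed⇔TailAgrees : ∀ r k lam μ → length μ ≡ r →
                       tailFixed r k lam μ ≡ true ⇔ TailAgrees k μ (topRow r lam)
tailFixed⇔TailAgrees r k lam μ len = ⇔-trans (allᵇ⇔All _ (oneTo r)) (mk⇔ to from)
  where
  κ = topRow r lam
  fixedAt : ℕ → Set
  fixedAt j = (not (suc k ℕ.<ᵇ j) ∨ (nth μ (j ∸ 1) ==ᶻ (nth (toList lam) j ℤ.+ + (r ∸ j)))) ≡ true
  beyond : ∀ s → r ≤ s → nth μ s ≡ nth κ (suc s)
  beyond s r≤s =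
    trans (nth-beyond μ s (subst (_≤ s) (sym len) r≤s))
          (sym (nth-beyond κ (suc s) (subst (_≤ suc s) (sym (length-topRow r lam)) (s≤s r≤s))))
  to : All fixedAt (oneTo r) → TailAgrees k μ κ
  to fixed s k<s with s ℕ.<? r
  ... | no  s≮r = beyond s (ℕP.≮⇒≥ s≮r)
  ... | yes s<r =
    trans (==ᶻ⇒≡ (Equivalence.to (not∨⇔ _ _) (All.applyUpTo⁻ id r (All.map⁻ fixed) s<r) (<⇒<ᵇ≡true k<s)))
          (sym (nth-topRow r lam (suc s)))
  from : TailAgrees k μ κ → All fixedAt (oneTo r)
  from agrees = All.map⁺ (All.applyUpTo⁺₁ id r (λ {s} _ → Equivalence.from (not∨⇔ _ _)
    (λ k<ᵇs → ≡⇒==ᶻ (trans (agrees s (<ᵇ≡true⇒< k<ᵇs)) (nth-topRow r lam (suc s))))))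

differences-vanish⇔TailAgrees : ∀ k μ κ → length κ ≡ suc (length μ) →
  (∀ s → k < s → nth (zipWith ℤ._-_ μ (drop 1 κ)) s ≡ + 0) ⇔ TailAgrees k μ κ
differences-vanish⇔TailAgrees k μ κ len = mk⇔
  (λ vanish s k<s → ℤP.i-j≡0⇒i≡j _ _ (trans (sym (difference s)) (vanish s k<s)))
  (λ agrees s k<s → trans (difference s) (ℤP.i≡j⇒i-j≡0 (agrees s k<s)))
  where
  len-drop : length μ ≡ length (drop 1 κ)
  len-drop = sym (trans (List.length-drop 1 κ) (cong (_∸ 1) len))
  difference : ∀ s → nth (zipWith ℤ._-_ μ (drop 1 κ)) s ≡ nth μ s ℤ.- nth κ (suc s)
  difference s = trans (nth-zipWith ℤ._-_ refl μ (drop 1 κ) len-drop s)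
                       (cong (λ z → nth μ s ℤ.- z) (nth-drop1 κ s))

firstRow≡tailFixed : ∀ r k lam μ → length μ ≡ r →
  demRow (r C 2) (r C 2 ℕ.+ k ℕ.+ 1) 0 (topRow r lam) μ ≡ tailFixed r k lam μ
firstRow≡tailFixed r k lam μ len = ≡true-ext (begin
  demRow (r C 2) (r C 2 ℕ.+ k ℕ.+ 1) 0 κ μ ≡ true
    ≈⟨ mk⇔ (demRow⇒suffixSums (r C 2) k 0 κ μ len-κ) (suffixSums⇒demRow (r C 2) k 0 κ μ len-κ) ⟩
  (∀ s → k < s → suffixSum D s ≡ + 0)
    ≈⟨ suffixSums-vanish⇔entries-vanish k D ⟩
  (∀ s → k < s → nth D s ≡ + 0)
    ≈⟨ differences-vanish⇔TailAgrees k μ κ len-κ ⟩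
  TailAgrees k μ κ
    ≈⟨ tailFixed⇔TailAgrees r k lam μ len ⟨
  tailFixed r k lam μ ≡ true ∎)
  where
  open import Relation.Binary.Reasoning.Setoid (⇔-setoid 0ℓ)
  κ = topRow r lam
  D = zipWith ℤ._-_ μ (drop 1 κ)
  len-κ : length κ ≡ suc (length μ)
  len-κ = trans (length-topRow r lam) (cong suc (sym len))

demazure-condition : ∀ r' k lam μ rows → length μ ≡ suc r' → Triangular r' rows →
  demAll (suc r') (lengthW (suc r') k) 1 (topRow (suc r') lam ∷ μ ∷ rows) ≡ tailFixed (suc r') k lam μ
demazure-condition r' k lam μ rows len shape = begin
  demRow (r C 2) ℓ 0 (topRow r lam) μ ∧ demAll r ℓ 2 (μ ∷ rows)
    ≡⟨ cong₂ _∧_ (firstRow≡tailFixed r k lam μ len)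
                 (demAll-vacuous r ℓ 2 r' μ rows shape (sym (ℕP.pred[m∸n]≡m∸[1+n] r' 0)) lower-rows) ⟩
  tailFixed r k lam μ ∧ true
    ≡⟨ ∧-identityʳ _ ⟩
  tailFixed r k lam μ ∎
  where
  open ≡-Reasoning
  r = suc r'
  ℓ = lengthW r k
  lower-rows : r C 2 ≤ ℓ
  lower-rows = ℕP.≤-trans (ℕP.m≤m+n (r C 2) k) (ℕP.m≤m+n (r C 2 ℕ.+ k) 1)

-- Weight vectors

zipWith-∷ʳ : ∀ {A B C : Set} (f : A → B → C) {xs ys} x y → length xs ≡ length ys →
             zipWith f (xs ∷ʳ x) (ys ∷ʳ y) ≡ zipWith f xs ys ∷ʳ f x y
zipWith-∷ʳ f {[]}     {[]}     x y _   = refl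
zipWith-∷ʳ f {_ ∷ xs} {_ ∷ ys} x y len =
  cong (_ ∷_) (zipWith-∷ʳ f {xs} {ys} x y (ℕP.suc-injective len))

length-diffs : ∀ l → length (diffs l) ≡ length l
length-diffs []          = refl
length-diffs (x ∷ [])    = refl
length-diffs (x ∷ y ∷ l) = cong suc (length-diffs (y ∷ l))

length-wt : ∀ rows → length (wt rows) ≡ length rows
length-wt rows = trans (List.length-reverse (diffs (map sumℤ rows)))
                       (trans (length-diffs (map sumℤ rows)) (List.length-map sumℤ rows))

shifted-wt : List (List ℤ) → ℕ → List ℤ
shifted-wt rows m = addL (wt rows) (negL (w0 (rhoL m)))

shifted-wt-∷ : ∀ r' κ μ rows → length rows ≡ r' →
  shifted-wt (κ ∷ μ ∷ rows) (suc r')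
    ≡ shifted-wt (μ ∷ rows) r' ∷ʳ (sumℤ κ ℤ.- sumℤ μ ℤ.- + suc r')
shifted-wt-∷ r' κ μ rows len = begin
  addL (wt (κ ∷ μ ∷ rows)) (negL (reverse (rhoL (suc r'))))
    ≡⟨ cong₂ addL (List.unfold-reverse (sumℤ κ ℤ.- sumℤ μ) (diffs (sumℤ μ ∷ map sumℤ rows))) ρ-step ⟩
  addL (wt (μ ∷ rows) ∷ʳ (sumℤ κ ℤ.- sumℤ μ)) (negL (reverse (rhoL r')) ∷ʳ ℤ.- + suc r')
    ≡⟨ zipWith-∷ʳ ℤ._+_ _ _ same-length ⟩
  shifted-wt (μ ∷ rows) r' ∷ʳ (sumℤ κ ℤ.- sumℤ μ ℤ.- + suc r') ∎
  where
  open ≡-Reasoning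
  ρ-step : negL (reverse (rhoL (suc r'))) ≡ negL (reverse (rhoL r')) ∷ʳ ℤ.- + suc r'
  ρ-step = trans (cong (negL ∘ reverse) (rhoL-suc r'))
                 (trans (cong negL (List.unfold-reverse (+ suc r') (rhoL r')))
                        (List.map-++ ℤ.-_ (reverse (rhoL r')) _))
  same-length : length (wt (μ ∷ rows)) ≡ length (negL (reverse (rhoL r')))
  same-length = begin
    length (wt (μ ∷ rows))             ≡⟨ length-wt (μ ∷ rows) ⟩
    suc (length rows)                  ≡⟨ cong suc len ⟩
    suc r'                             ≡⟨ length-rhoL r' ⟨
    length (rhoL r')                   ≡⟨ List.length-reverse (rhoL r') ⟨
    length (reverse (rhoL r'))         ≡⟨ List.length-map ℤ.-_ (reverse (rhoL r')) ⟨
    length (negL (reverse (rhoL r')))  ∎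

staircase : List ℤ → ℕ → List (List ℤ)
staircase u zero    = []
staircase u (suc m) = u ∷ staircase (drop 1 u) m

drop-suc : ∀ i (u : List ℤ) → drop (suc i) u ≡ drop i (drop 1 u)
drop-suc i []      = sym (List.drop-[] i)
drop-suc i (a ∷ u) = refl

drops≡staircase : ∀ m μ → map (λ i → drop i μ) (upTo m) ≡ staircase μ m
drops≡staircase m μ = trans (List.map-upTo (λ i → drop i μ) m) (go m μ)
  where
  go : ∀ m μ → applyUpTo (λ i → drop i μ) m ≡ staircase μ m
  go zero    μ = refl
  go (suc m) μ = cong (μ ∷_) (trans (applyUpTo-cong (λ i → drop-suc i μ) m) (go m (drop 1 μ)))

-- Finite sums in a commutative ring

module Sums {c ℓ : Level} (R : CommutativeRing c ℓ) where
  open CommutativeRing R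
    renaming (refl to ≈-refl; sym to ≈-sym; trans to ≈-trans; reflexive to ≈-reflexive)
  open import Relation.Binary.Reasoning.Setoid setoid

  Σ : ∀ {a} {A : Set a} → (A → Carrier) → List A → Carrier
  Σ h xs = foldr _+_ 0# (map h xs)

  indicator : Bool → Carrier → Carrier
  indicator b x = if b then x else 0#

  module _ {a} {A : Set a} where

    Σ-++ : ∀ (h : A → Carrier) xs ys → Σ h (xs ++ ys) ≈ Σ h xs + Σ h ys
    Σ-++ h []       ys = ≈-sym (+-identityˡ _)
    Σ-++ h (x ∷ xs) ys = ≈-trans (+-congˡ (Σ-++ h xs ys)) (≈-sym (+-assoc _ _ _))

    Σ-cong-All : ∀ {p} {P : A → Set p} {h h' : A → Carrier} {xs} → All P xs →
                 (∀ {x} → P x → h x ≈ h' x) → Σ h xs ≈ Σ h' xs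
    Σ-cong-All []         _  = ≈-refl
    Σ-cong-All (px ∷ pxs) eq = +-cong (eq px) (Σ-cong-All pxs eq)

    Σ-cong : ∀ {h h' : A → Carrier} xs → (∀ x → h x ≈ h' x) → Σ h xs ≈ Σ h' xs
    Σ-cong xs eq = Σ-cong-All (All.universal (λ _ → tt) xs) (λ {x} _ → eq x)

    Σ-zero-All : ∀ {p} {P : A → Set p} {h : A → Carrier} {xs} → All P xs →
                 (∀ {x} → P x → h x ≈ 0#) → Σ h xs ≈ 0#
    Σ-zero-All []         _    = ≈-refl
    Σ-zero-All (px ∷ pxs) vanish = ≈-trans (+-cong (vanish px) (Σ-zero-All pxs vanish)) (+-identityˡ 0#)

    Σ-zero : ∀ {h : A → Carrier} xs → (∀ x → h x ≈ 0#) → Σ h xs ≈ 0#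
    Σ-zero xs vanish = Σ-zero-All (All.universal (λ _ → tt) xs) (λ {x} _ → vanish x)

    Σ-filterᵇ : ∀ (h : A → Carrier) p xs →
                Σ h (filterᵇ p xs) ≈ Σ (λ x → indicator (p x) (h x)) xs
    Σ-filterᵇ h p []       = ≈-refl
    Σ-filterᵇ h p (x ∷ xs) with p x
    ... | true  = +-congˡ (Σ-filterᵇ h p xs)
    ... | false = ≈-trans (Σ-filterᵇ h p xs) (≈-sym (+-identityˡ _))

    Σ-indicator : ∀ b (h : A → Carrier) xs → Σ (λ x → indicator b (h x)) xs ≈ indicator b (Σ h xs)
    Σ-indicator true  h xs = ≈-refl
    Σ-indicator false h xs = Σ-zero xs (λ _ → ≈-refl)

  module _ {a b} {A : Set a} {B : Set b} where

    Σ-map : ∀ (h : B → Carrier) (f : A → B) xs → Σ h (map f xs) ≡ Σ (h ∘ f) xs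
    Σ-map h f xs = cong (foldr _+_ 0#) (sym (List.map-∘ xs))

    Σ-concatMap : ∀ (h : B → Carrier) (f : A → List B) xs →
                  Σ h (concatMap f xs) ≈ Σ (λ x → Σ h (f x)) xs
    Σ-concatMap h f []       = ≈-refl
    Σ-concatMap h f (x ∷ xs) = ≈-trans (Σ-++ h (f x) (concatMap f xs)) (+-congˡ (Σ-concatMap h f xs))

  Σ-∷-product : ∀ {a} {A : Set a} (F : List A → Carrier) xs ys →
                Σ F (concatMap (λ x → map (x ∷_) ys) xs) ≈ Σ (λ x → Σ (F ∘ (x ∷_)) ys) xs
  Σ-∷-product F xs ys =
    ≈-trans (Σ-concatMap F (λ x → map (x ∷_) ys) xs)
            (Σ-cong xs (λ x → ≈-reflexive (Σ-map F (x ∷_) ys)))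

  indicator-∧ : ∀ a b x → indicator (a ∧ b) x ≡ indicator a (indicator b x)
  indicator-∧ true  b x = refl
  indicator-∧ false b x = refl

  indicator-comm : ∀ a b x → indicator a (indicator b x) ≡ indicator b (indicator a x)
  indicator-comm true  true  x = refl
  indicator-comm true  false x = refl
  indicator-comm false true  x = refl
  indicator-comm false false x = refl

  indicator-cong : ∀ b {x y} → (b ≡ true → x ≈ y) → indicator b x ≈ indicator b y
  indicator-cong true  eq = eq refl
  indicator-cong false eq = ≈-refl

  module _ {lo lo' hi' hi} (lo≤lo' : lo ℤ.≤ lo') (lo'≤hi' : lo' ℤ.≤ hi') (hi'≤hi : hi' ℤ.≤ hi) where
    private
      B  = boxℤ lo hi
      B' = boxℤ lo' hi'

    Σ-boxℤ : ∀ (f : ℤ → Carrier) → (∀ x → ¬ Within lo' hi' x → f x ≈ 0#) → Σ f B ≈ Σ f B'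
    Σ-boxℤ f outside with boxℤ-split lo≤lo' lo'≤hi' hi'≤hi
    ... | xs , ys , split , below , above = begin
      Σ f B                         ≡⟨ cong (Σ f) split ⟩
      Σ f (xs ++ B' ++ ys)          ≈⟨ ≈-trans (Σ-++ f xs _) (+-congˡ (Σ-++ f B' ys)) ⟩
      Σ f xs + (Σ f B' + Σ f ys)    ≈⟨ +-cong (Σ-zero-All below (outside _ ∘ ¬Within-below))
                                              (+-congˡ (Σ-zero-All above (outside _ ∘ ¬Within-above))) ⟩
      0# + (Σ f B' + 0#)            ≈⟨ ≈-trans (+-identityˡ _) (+-identityʳ _) ⟩
      Σ f B'                        ∎

    Σ-vecs : ∀ m (F : List ℤ → Carrier) → (∀ xs → ¬ All (Within lo' hi') xs → F xs ≈ 0#) →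
             Σ F (vecs m B) ≈ Σ F (vecs m B')
    Σ-vecs zero    F outside = ≈-refl
    Σ-vecs (suc m) F outside = begin
      Σ F (vecs (suc m) B)
        ≈⟨ Σ-∷-product F B (vecs m B) ⟩
      Σ (λ x → Σ (F ∘ (x ∷_)) (vecs m B)) B
        ≈⟨ Σ-cong B (λ x → Σ-vecs m (F ∘ (x ∷_)) (λ xs ¬in → outside (x ∷ xs) (¬in ∘ All.tail))) ⟩
      Σ (λ x → Σ (F ∘ (x ∷_)) (vecs m B')) B
        ≈⟨ Σ-boxℤ _ (λ x ¬in → Σ-zero (vecs m B') (λ xs → outside (x ∷ xs) (¬in ∘ All.head))) ⟩
      Σ (λ x → Σ (F ∘ (x ∷_)) (vecs m B')) B'
        ≈⟨ Σ-∷-product F B' (vecs m B') ⟨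
      Σ F (vecs (suc m) B') ∎

    Σ-arrays : ∀ m (F : List (List ℤ) → Carrier) → (∀ xss → ¬ All (All (Within lo' hi')) xss → F xss ≈ 0#) →
               Σ F (arrays m B) ≈ Σ F (arrays m B')
    Σ-arrays zero    F outside = ≈-refl
    Σ-arrays (suc m) F outside = begin
      Σ F (arrays (suc m) B)
        ≈⟨ Σ-∷-product F (vecs (suc m) B) (arrays m B) ⟩
      Σ (λ x → Σ (F ∘ (x ∷_)) (arrays m B)) (vecs (suc m) B)
        ≈⟨ Σ-cong (vecs (suc m) B) (λ x →
             Σ-arrays m (F ∘ (x ∷_)) (λ xs ¬in → outside (x ∷ xs) (¬in ∘ All.tail))) ⟩
      Σ (λ x → Σ (F ∘ (x ∷_)) (arrays m B')) (vecs (suc m) B)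
        ≈⟨ Σ-vecs (suc m) _ (λ x ¬in → Σ-zero (arrays m B') (λ xs → outside (x ∷ xs) (¬in ∘ All.head))) ⟩
      Σ (λ x → Σ (F ∘ (x ∷_)) (arrays m B')) (vecs (suc m) B')
        ≈⟨ Σ-∷-product F (vecs (suc m) B') (arrays m B') ⟨
      Σ F (arrays (suc m) B') ∎

-- The weights G

strict : List ℤ → Bool
strict (a ∷ b ∷ us) = (b <ᶻ a) ∧ strict (b ∷ us)
strict _            = true

strict-drop1 : ∀ u → strict u ≡ true → strict (drop 1 u) ≡ true
strict-drop1 []           _  = refl
strict-drop1 (a ∷ [])     _  = refl
strict-drop1 (a ∷ b ∷ us) eq = proj₂ (∧-true⁻ eq)

module Weights {c ℓ : Level} (R : CommutativeRing c ℓ) (v : CommutativeRing.Carrier R)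
               (g : ℤ → CommutativeRing.Carrier R) (n : ℕ) where
  open CommutativeRing R
    renaming (refl to ≈-refl; sym to ≈-sym; trans to ≈-trans; reflexive to ≈-reflexive)
  open Gen R v g n using (gfac; rowFactor; G)

  gfac-constant : ∀ x γ → gfac x x x γ ≡ 0#
  gfac-constant x γ rewrite ≤ᵇ-refl x = refl

  gfac-step : ∀ a b γ → (b <ᶻ a) ≡ true → gfac a b b γ ≡ 1#
  gfac-step a b γ b<a rewrite ≤ᵇ-refl b | b<a = refl

  rowFactor-strict : ∀ u → strict u ≡ true → rowFactor u (drop 1 u) ≈ 1#
  rowFactor-strict []           _  = ≈-refl
  rowFactor-strict (a ∷ [])     _  = ≈-refl
  rowFactor-strict (a ∷ b ∷ us) eq = ≈-trans
    (*-cong (≈-reflexive (gfac-step a b _ (proj₁ (∧-true⁻ eq))))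
            (rowFactor-strict (b ∷ us) (proj₂ (∧-true⁻ eq))))
    (*-identityˡ 1#)

  G-staircase : ∀ m u → strict u ≡ true → G (u ∷ staircase (drop 1 u) m) ≈ 1#
  G-staircase zero    u _  = ≈-refl
  G-staircase (suc m) u eq =
    ≈-trans (*-cong (rowFactor-strict u eq) (G-staircase m (drop 1 u) (strict-drop1 u eq))) (*-identityˡ 1#)

  -- A repeated entry a = b of u forces the entry of w between them to equal both, and gfac vanishes there.
  rowFactor-nonstrict : ∀ u w → interleave u w ≡ true → strict u ≡ false → rowFactor u w ≈ 0#
  rowFactor-nonstrict (a ∷ b ∷ us) (c ∷ ws) uw-interleave nonstrict
    with interleave-∷⁻ a b c us ws uw-interleave | b <ᶻ a in b<a
  ... | _ , _ , tail-interleave | true =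
    ≈-trans (*-congˡ (rowFactor-nonstrict (b ∷ us) ws tail-interleave nonstrict)) (zeroʳ _)
  ... | c≤a , b≤c , _ | false =
    ≈-trans (*-congʳ (≈-reflexive (trans (cong₂ (λ x y → gfac x y c γ) a≡c b≡c) (gfac-constant c γ)))) (zeroˡ _)
    where
    γ = Γ (a ∷ b ∷ us) (c ∷ ws)
    a≤b = <ᶻ≡false⇒≥ (ℤP.≤-trans b≤c c≤a) b<a
    a≡c : a ≡ c
    a≡c = ℤP.≤-antisym (ℤP.≤-trans a≤b b≤c) c≤a
    b≡c : b ≡ c
    b≡c = ℤP.≤-antisym b≤c (ℤP.≤-trans c≤a a≤b)

  G-staircase-absorbed : ∀ m μ rows → Triangular m rows → isPattern (μ ∷ rows) ≡ true →
                         G (μ ∷ staircase (drop 1 μ) m) * G (μ ∷ rows) ≈ G (μ ∷ rows)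
  G-staircase-absorbed zero    μ []         []      _       = *-identityˡ _
  G-staircase-absorbed (suc m) μ (w ∷ rows) (_ ∷ _) is-pattern with strict μ in μ-strict
  ... | true  = ≈-trans (*-congʳ (G-staircase (suc m) μ μ-strict)) (*-identityˡ _)
  ... | false = ≈-trans (*-congˡ vanishes) (≈-trans (zeroʳ _) (≈-sym vanishes))
    where
    vanishes : G (μ ∷ w ∷ rows) ≈ 0#
    vanishes = ≈-trans (*-congʳ (rowFactor-nonstrict μ w (proj₁ (∧-true⁻ is-pattern)) μ-strict)) (zeroˡ _)

-- Expansion along the second row

module Expansion {c ℓ : Level} (R : CommutativeRing c ℓ) (v : CommutativeRing.Carrier R)
                 (g : ℤ → CommutativeRing.Carrier R) (n : ℕ) where
  open CommutativeRing R
    renaming (refl to ≈-refl; sym to ≈-sym; trans to ≈-trans; reflexive to ≈-reflexive)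
  open Gen R v g n
  open Sums R
  open Weights R v g n
  open import Relation.Binary.Reasoning.Setoid setoid

  monomialCoeff : List ℤ → Carrier × List ℤ → Carrier
  monomialCoeff ν (a , e) = indicator (e ==ᴸ ν) a

  coeff≡Σ : ∀ ν p → coeff ν p ≡ Σ (monomialCoeff ν) p
  coeff≡Σ ν []            = refl
  coeff≡Σ ν ((a , e) ∷ p) = cong (_+_ (indicator (e ==ᴸ ν) a)) (coeff≡Σ ν p)

  module _ (r' k : ℕ) (lam : Vec ℤ (suc (suc r'))) (ν : List ℤ) where
    private
      r = suc r'
      κ = topRow r lam
      B = boxℤ (lower κ) (upper κ)

    lhsTerm : List (List ℤ) → Carrier
    lhsTerm T = indicator (isPattern T)
                  (indicator (demAll r (lengthW r k) 1 T) (monomialCoeff ν (G T , shifted-wt T r)))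

    rhsTerm : List ℤ → List (List ℤ) → Carrier × List ℤ
    rhsTerm μ T' = G (Tstar r k lam μ) * G T' , shifted-wt T' r' ∷ʳ (sumℤ κ ℤ.- sumℤ μ ℤ.- + r)

    fibreTerm : List ℤ → List (List ℤ) → Carrier
    fibreTerm μ rows = indicator (isPattern (μ ∷ rows)) (monomialCoeff ν (rhsTerm μ (μ ∷ rows)))

    fibre : List ℤ → Carrier
    fibre μ = Σ (fibreTerm μ) (arrays r' (boxℤ (lower μ) (upper μ)))

    coeff-LHS : coeff ν (LHS r k lam) ≈ Σ (λ μ → Σ (λ rows → lhsTerm (κ ∷ μ ∷ rows)) (arrays r' B)) (vecs r B)
    coeff-LHS = begin
      coeff ν (LHS r k lam)
        ≡⟨ trans (coeff≡Σ ν (LHS r k lam)) (Σ-map (monomialCoeff ν) (λ T → G T , shifted-wt T r) (demazure r k κ)) ⟩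
      Σ (λ T → monomialCoeff ν (G T , shifted-wt T r)) (filterᵇ (demAll r (lengthW r k) 1) (patterns r κ))
        ≈⟨ Σ-filterᵇ _ (demAll r (lengthW r k) 1) (patterns r κ) ⟩
      Σ (λ T → indicator (demAll r (lengthW r k) 1 T) (monomialCoeff ν (G T , shifted-wt T r))) (patterns r κ)
        ≈⟨ Σ-filterᵇ _ isPattern (map (κ ∷_) (arrays r B)) ⟩
      Σ lhsTerm (map (κ ∷_) (arrays r B))
        ≡⟨ Σ-map lhsTerm (κ ∷_) (arrays r B) ⟩
      Σ (λ rows → lhsTerm (κ ∷ rows)) (arrays r B)
        ≈⟨ Σ-∷-product (lhsTerm ∘ (κ ∷_)) (vecs r B) (arrays r' B) ⟩
      Σ (λ μ → Σ (λ rows → lhsTerm (κ ∷ μ ∷ rows)) (arrays r' B)) (vecs r B) ∎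

    coeff-RHS : coeff ν (RHS r k lam) ≈ Σ (λ μ → indicator (goodμ r k lam μ) (fibre μ)) (vecs r B)
    coeff-RHS = begin
      coeff ν (RHS r k lam)
        ≡⟨ coeff≡Σ ν (RHS r k lam) ⟩
      Σ (monomialCoeff ν) (concatMap (λ μ → map (rhsTerm μ) (patterns r' μ)) (μs r k lam))
        ≈⟨ Σ-concatMap (monomialCoeff ν) _ (μs r k lam) ⟩
      Σ (λ μ → Σ (monomialCoeff ν) (map (rhsTerm μ) (patterns r' μ))) (μs r k lam)
        ≈⟨ Σ-filterᵇ _ (goodμ r k lam) (vecs r B) ⟩
      Σ (λ μ → indicator (goodμ r k lam μ) (Σ (monomialCoeff ν) (map (rhsTerm μ) (patterns r' μ)))) (vecs r B)
        ≈⟨ Σ-cong (vecs r B) (λ μ → indicator-cong (goodμ r k lam μ) (λ _ → fibre-as-sum μ)) ⟩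
      Σ (λ μ → indicator (goodμ r k lam μ) (fibre μ)) (vecs r B) ∎
      where
      fibre-as-sum : ∀ μ → Σ (monomialCoeff ν) (map (rhsTerm μ) (patterns r' μ)) ≈ fibre μ
      fibre-as-sum μ = begin
        Σ (monomialCoeff ν) (map (rhsTerm μ) (patterns r' μ))
          ≡⟨ Σ-map (monomialCoeff ν) (rhsTerm μ) (patterns r' μ) ⟩
        Σ (monomialCoeff ν ∘ rhsTerm μ) (filterᵇ isPattern (map (μ ∷_) candidates))
          ≈⟨ Σ-filterᵇ (monomialCoeff ν ∘ rhsTerm μ) isPattern (map (μ ∷_) candidates) ⟩
        Σ (λ T → indicator (isPattern T) (monomialCoeff ν (rhsTerm μ T))) (map (μ ∷_) candidates)
          ≡⟨ Σ-map (λ T → indicator (isPattern T) (monomialCoeff ν (rhsTerm μ T))) (μ ∷_) candidates ⟩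
        fibre μ ∎
        where
        candidates = arrays r' (boxℤ (lower μ) (upper μ))

    lowest-pattern-weight : ∀ μ rows → Triangular r' rows → isPattern (μ ∷ rows) ≡ true →
                            G (Tstar r k lam μ) * G (μ ∷ rows) ≈ G (κ ∷ μ ∷ rows)
    lowest-pattern-weight μ rows shape is-pattern = begin
      G (Tstar r k lam μ) * G (μ ∷ rows)
        ≡⟨ cong (λ s → G (κ ∷ s) * G (μ ∷ rows)) (drops≡staircase r μ) ⟩
      (rowFactor κ μ * G (μ ∷ staircase (drop 1 μ) r')) * G (μ ∷ rows)
        ≈⟨ *-assoc _ _ _ ⟩
      rowFactor κ μ * (G (μ ∷ staircase (drop 1 μ) r') * G (μ ∷ rows))
        ≈⟨ *-congˡ (G-staircase-absorbed r' μ rows shape is-pattern) ⟩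
      rowFactor κ μ * G (μ ∷ rows) ∎

    demazureTerm : List ℤ → List (List ℤ) → Carrier
    demazureTerm μ rows =
      indicator (isPattern (μ ∷ rows))
        (indicator (demAll r (lengthW r k) 1 (κ ∷ μ ∷ rows))
          (monomialCoeff ν (G (κ ∷ μ ∷ rows) , shifted-wt (κ ∷ μ ∷ rows) r)))

    demazureTerm≈fibreTerm : ∀ μ rows → length μ ≡ r → Triangular r' rows →
                             demazureTerm μ rows ≈ indicator (tailFixed r k lam μ) (fibreTerm μ rows)
    demazureTerm≈fibreTerm μ rows len shape = begin
      indicator P (indicator (demAll r (lengthW r k) 1 (κ ∷ μ ∷ rows)) x)
        ≡⟨ cong (λ D → indicator P (indicator D x)) (demazure-condition r' k lam μ rows len shape) ⟩
      indicator P (indicator (tailFixed r k lam μ) x)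
        ≡⟨ indicator-comm P (tailFixed r k lam μ) x ⟩
      indicator (tailFixed r k lam μ) (indicator P x)
        ≈⟨ indicator-cong (tailFixed r k lam μ) (λ _ → indicator-cong P same-monomial) ⟩
      indicator (tailFixed r k lam μ) (fibreTerm μ rows) ∎
      where
      P = isPattern (μ ∷ rows)
      x = monomialCoeff ν (G (κ ∷ μ ∷ rows) , shifted-wt (κ ∷ μ ∷ rows) r)
      same-monomial : P ≡ true → x ≈ monomialCoeff ν (rhsTerm μ (μ ∷ rows))
      same-monomial is-pattern = ≈-trans
        (≈-reflexive (cong (λ e → monomialCoeff ν (G (κ ∷ μ ∷ rows) , e))
                           (shifted-wt-∷ r' κ μ rows (Triangular-length shape))))
        (indicator-cong _ (λ _ → ≈-sym (lowest-pattern-weight μ rows shape is-pattern)))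

    Σ-demazureTerm : ∀ μ → length μ ≡ r → interleave κ μ ≡ true →
                     Σ (demazureTerm μ) (arrays r' B) ≈ indicator (tailFixed r k lam μ) (fibre μ)
    Σ-demazureTerm μ len interleaved-μ = begin
      Σ (demazureTerm μ) (arrays r' B)
        ≈⟨ Σ-arrays lower-κ≤lower-μ (lower≤upper μ) upper-μ≤upper-κ r' (demazureTerm μ) outside ⟩
      Σ (demazureTerm μ) (arrays r' Bμ)
        ≈⟨ Σ-cong-All (arrays-triangular r' Bμ) (demazureTerm≈fibreTerm μ _ len) ⟩
      Σ (λ rows → indicator (tailFixed r k lam μ) (fibreTerm μ rows)) (arrays r' Bμ)
        ≈⟨ Σ-indicator (tailFixed r k lam μ) (fibreTerm μ) (arrays r' Bμ) ⟩
      indicator (tailFixed r k lam μ) (fibre μ) ∎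
      where
      Bμ = boxℤ (lower μ) (upper μ)
      μ-within = interleave⇒Within κ μ interleaved-μ
      lower-κ≤lower-μ = All-Within⇒lower≤lower μ (lower≤0 κ) μ-within
      upper-μ≤upper-κ = All-Within⇒upper≤upper μ (0≤upper κ) μ-within
      outside : ∀ rows → ¬ All (All (Within (lower μ) (upper μ))) rows → demazureTerm μ rows ≈ 0#
      outside rows ¬within with isPattern (μ ∷ rows) in is-pattern
      ... | true  = ⊥-elim (¬within (isPattern⇒Within μ rows is-pattern))
      ... | false = ≈-refl

    fibre-sum : ∀ μ → length μ ≡ r →
                Σ (λ rows → lhsTerm (κ ∷ μ ∷ rows)) (arrays r' B) ≈ indicator (goodμ r k lam μ) (fibre μ)
    fibre-sum μ len = begin
      Σ (λ rows → lhsTerm (κ ∷ μ ∷ rows)) (arrays r' B)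
        ≈⟨ Σ-cong (arrays r' B) (λ rows → ≈-reflexive (indicator-∧ (interleave κ μ) (isPattern (μ ∷ rows)) _)) ⟩
      Σ (λ rows → indicator (interleave κ μ) (demazureTerm μ rows)) (arrays r' B)
        ≈⟨ Σ-indicator (interleave κ μ) (demazureTerm μ) (arrays r' B) ⟩
      indicator (interleave κ μ) (Σ (demazureTerm μ) (arrays r' B))
        ≈⟨ indicator-cong (interleave κ μ) (Σ-demazureTerm μ len) ⟩
      indicator (interleave κ μ) (indicator (tailFixed r k lam μ) (fibre μ))
        ≡⟨ indicator-∧ (interleave κ μ) (tailFixed r k lam μ) (fibre μ) ⟨
      indicator (goodμ r k lam μ) (fibre μ) ∎

proposition6p6 : ∀ {c ℓ : Level} (R : CommutativeRing c ℓ)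
    (v : CommutativeRing.Carrier R) (g : ℤ → CommutativeRing.Carrier R)
    (r n k : ℕ) → 1 ≤ r → 1 ≤ n → k < r →
    (lam : Vec ℤ (suc r)) → Dominant lam →
    (ν : Vec ℤ (suc r)) →
    CommutativeRing._≈_ R
      (Gen.coeff R v g n (toList ν) (Gen.LHS R v g n r k lam))
      (Gen.coeff R v g n (toList ν) (Gen.RHS R v g n r k lam))
proposition6p6 R v g (suc r') n k _ _ _ lam _ ν = begin
  coeff ν' (LHS r k lam)
    ≈⟨ coeff-LHS r' k lam ν' ⟩
  Σ (λ μ → Σ (λ rows → lhsTerm r' k lam ν' (κ ∷ μ ∷ rows)) (arrays r' B)) (vecs r B)
    ≈⟨ Σ-cong-All (vecs-length r B) (fibre-sum r' k lam ν' _) ⟩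
  Σ (λ μ → indicator (goodμ r k lam μ) (fibre r' k lam ν' μ)) (vecs r B)
    ≈⟨ coeff-RHS r' k lam ν' ⟨
  coeff ν' (RHS r k lam) ∎
  where
  open CommutativeRing R using (setoid)
  open Gen R v g n using (coeff; LHS; RHS; goodμ)
  open Sums R using (Σ; Σ-cong-All; indicator)
  open Expansion R v g n
  open import Relation.Binary.Reasoning.Setoid setoid
  r = suc r'
  ν' = toList ν
  κ = topRow r lam
  B = boxℤ (lower κ) (upper κ)
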